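{- Let $n\ge 4$ and let $AQ_n=\mathrm{Cay}(\mathbb{Z}_2^n,S)$ be the augmented cube graph. Let $G=\mathrm{Aut}(AQ_n)$ and let $G_e$ be the stabilizer in $G$ of the zero vector $e$. Then every element of $G_e$ is (the action on $\mathbb{Z}_2^n$ of) an invertible $\mathbb{F}_2$-linear transformation of $\mathbb{Z}_2^n$ that maps $S$ onto itself; consequently $G_e\subseteq \mathrm{Aut}(\mathbb{Z}_2^n,S)$.
   Context: For a group $H$ and a subset $S\subseteq H$ not containing the identity and closed under inverses, $\mathrm{Cay}(H,S)$ is the undirected graph with vertex set $H$ in which $h$ and $sh$ are adjacent for all $h\in H$, $s\in S$. Identify $\mathbb{Z}_2^n$ with the vector space $\mathbb{F}_2^n$; $e_i$ is the $i$-th unit vector. The augmented cube graph $AQ_n$ is $\mathrm{Cay}(\mathbb{Z}_2^n,S)$ where $S=\{e_1,\dots,e_n\}\cup\{e_{n-k+1}+e_{n-k+2}+\cdots+e_n : 2\le k\le n\}$ (i.e. $S$ consists of the unit vectors together with $00\cdots011, 00\cdots0111,\dots,11\cdots1$; $|S|=2n-1$). $\mathrm{Aut}(\mathbb{Z}_2^n,S)$ is the group of group automorphisms of $\mathbb{Z}_2^n$ mapping $S$ onto itself. -}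

module Defs where

open import Data.Nat using (ℕ; zero; suc; _≤_; _∸_; _≤ᵇ_)
open import Data.Bool using (Bool; true; false; _xor_)
open import Data.Vec using (Vec; []; _∷_; replicate; zipWith; tabulate)
open import Data.Fin using (Fin; toℕ; _≟_)
open import Relation.Nullary.Decidable using (⌊_⌋)
open import Data.Product using (Σ; ∃; _×_; _,_)
open import Data.Sum using (_⊎_)
open import Function.Bundles using (_↔_; Inverse)
open import Relation.Binary.PropositionalEquality using (_≡_)

-- Z_2^n identified with F_2^n: bit vectors of length n.
-- Position i : Fin n (0-based) corresponds to the coordinate of e_{i+1}.
V : ℕ → Set
V n = Vec Bool n

_⊕_ : ∀ {n} → V n → V n → V n
_⊕_ = zipWith _xor_

𝟎 : ∀ {n} → V n
𝟎 = replicate _ false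

unit : ∀ {n} → Fin n → V n
unit {n} i = tabulate (λ j → ⌊ i ≟ j ⌋)

-- e_{n-k+1} + ... + e_n : coordinates (0-based) j with n ∸ k ≤ j are 1
tailOnes : ∀ {n} → ℕ → V n
tailOnes {n} k = tabulate (λ j → (n ∸ k) ≤ᵇ toℕ j)

data InS {n : ℕ} : V n → Set where
  unitS : (i : Fin n) → InS (unit i)
  tailS : (k : ℕ) → 2 ≤ k → k ≤ n → InS (tailOnes k)

Adj : ∀ {n} → V n → V n → Set
Adj {n} u v = Σ (V n) λ s → InS s × (v ≡ s ⊕ u)

record IsGraphAut {n : ℕ} (σ : V n ↔ V n) : Set where
  open Inverse σ using (to)
  field
    adj⇒ : ∀ u v → Adj u v → Adj (to u) (to v)
    adj⇐ : ∀ u v → Adj (to u) (to v) → Adj u v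

-- Write n = k + 2 with k ≥ 2, let U p be the unit vector at coordinate p and
-- F t the vector with ones exactly at coordinates ≥ t, so F n = 𝟎 and
-- U t = F t ⊕ F (t+1).  Then S = {U p | p < n} ∪ {F t | t < n}, and
-- F 0, …, F (n-1) form a basis of V n.
--
-- Let σ be a graph automorphism with σ 𝟎 = 𝟎.  Since x ~ y iff x ⊕ y ∈ S, σ
-- preserves and reflects "difference in S"; in particular σ(S) ⊆ S.  The key
-- step: if σ(x⊕a) = σx ⊕ A and σ(x⊕b) = σx ⊕ B with A, B ∈ S, then
-- z = σ⁻¹(σx ⊕ A ⊕ B) is a common neighbour of x⊕a and x⊕b, i.e. z = c ⊕ x ⊕ a
-- with c ∈ S and a ⊕ b ⊕ c ∈ S.  When a, b are "separated" (the only such c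
-- are a and b) this yields σ(x⊕a⊕b) = σx ⊕ A ⊕ B.  Coordinate computations
-- show that F t, F s are separated unless s = t+2; in that case the two extra
-- candidates U t, U (t+1) are ruled out by non-adjacency.  Hence
-- σ(x ⊕ F t) = σx ⊕ σ(F t) for all x and t (induction along the basis), which
-- gives additivity, and σ, σ⁻¹ map S into S.
module Submission where

open import Defs
open import Data.Nat using (ℕ; _≤_)
open import Data.Product using (Σ; _×_)
open import Function.Bundles using (_↔_; Inverse)
open import Relation.Binary.PropositionalEquality using (_≡_)

open import Data.Nat using (zero; suc; _<_; _∸_; z≤n; s≤s; _≤ᵇ_; _≟_; _<?_; _≤?_)
open import Data.Nat.Properties
  using (≤ᵇ⇒≤; ≤⇒≤ᵇ; <-cmp; ≤-trans; ≤-refl; m∸[m∸n]≡n; m∸n≤m; n≤1+n; <⇒≤; ≤-pred;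
         <-trans; <⇒≢; m≤n⇒m≤1+n; ≤-antisym; ≮⇒≥; <⇒≱; 1+n≢n; ≤∧≢⇒<; ≤-reflexive; <-≤-trans)
open import Data.Bool using (Bool; true; false; _xor_; not; T; _∧_)
open import Data.Bool.Properties using (xor-same; xor-identityʳ)
open import Data.Vec using (Vec; []; _∷_; tabulate; lookup)
open import Data.Vec.Properties using (tabulate-cong)
open import Data.Fin using (Fin; toℕ; fromℕ<) renaming (zero to fz; suc to fs)
open import Data.Fin.Properties using (toℕ<n; toℕ-fromℕ<; toℕ-injective)
open import Data.Product using (_,_)
open import Data.Sum using (_⊎_; inj₁; inj₂)
open import Data.Empty using (⊥; ⊥-elim)
open import Data.Unit using (tt)
open import Relation.Nullary using (¬_; Dec; yes; no)
open import Relation.Nullary.Decidable using (⌊_⌋)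
open import Relation.Binary.PropositionalEquality
  using (refl; sym; trans; cong; cong₂; subst; module ≡-Reasoning)
open import Relation.Binary using (tri<; tri≈; tri>)

open ≡-Reasoning

-- Coordinate m of F t is  ge t m  (t ≤ m) and of U p is  eq p m  (p = m).
-- Both are defined by structural recursion so that they compute on successors.

ge : ℕ → ℕ → Bool
ge zero m = true
ge (suc t) zero = false
ge (suc t) (suc m) = ge t m

eq : ℕ → ℕ → Bool
eq zero zero = true
eq zero (suc m) = false
eq (suc p) zero = false
eq (suc p) (suc m) = eq p m

ge-yes : ∀ {t m} → t ≤ m → ge t m ≡ true
ge-yes z≤n = refl
ge-yes (s≤s h) = ge-yes h

ge-no : ∀ {t m} → m < t → ge t m ≡ false
ge-no {suc t} {zero} h = refl
ge-no {suc t} {suc m} (s≤s h) = ge-no h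

ge→ : ∀ t m → ge t m ≡ true → t ≤ m
ge→ zero m h = z≤n
ge→ (suc t) (suc m) h = s≤s (ge→ t m h)

ge→' : ∀ t m → ge t m ≡ false → m < t
ge→' (suc t) zero h = s≤s z≤n
ge→' (suc t) (suc m) h = s≤s (ge→' t m h)

eq-refl : ∀ p → eq p p ≡ true
eq-refl zero = refl
eq-refl (suc p) = eq-refl p

eq-no : ∀ {p m} → ¬ p ≡ m → eq p m ≡ false
eq-no {zero} {zero} h = ⊥-elim (h refl)
eq-no {zero} {suc m} h = refl
eq-no {suc p} {zero} h = refl
eq-no {suc p} {suc m} h = eq-no (λ e → h (cong suc e))

eq→ : ∀ p m → eq p m ≡ true → p ≡ m
eq→ zero zero h = refl
eq→ (suc p) (suc m) h = cong suc (eq→ p m h)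

ge≡≤ᵇ : ∀ t m → ge t m ≡ (t ≤ᵇ m)
ge≡≤ᵇ t m with t ≤ᵇ m in e
... | true = ge-yes (≤ᵇ⇒≤ t m (subst T (sym e) tt))
... | false with ge t m in e2
...   | false = refl
...   | true = ⊥-elim (subst T e (≤⇒≤ᵇ (ge→ t m e2)))

-- The coordinatewise form of U t = F t ⊕ F (t+1).
ge-window : ∀ t m → (ge t m xor ge (suc t) m) ≡ eq t m
ge-window zero zero = refl
ge-window zero (suc m) = refl
ge-window (suc t) zero = refl
ge-window (suc t) (suc m) = ge-window t m

xor-true : ∀ b → (b xor true) ≡ not b
xor-true true = refl
xor-true false = refl

not-false : ∀ {b} → not b ≡ false → b ≡ true
not-false {true} h = refl

not-true : ∀ {b} → not b ≡ true → b ≡ false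
not-true {false} h = refl

pt : ∀ {n} → V n → ℕ → Bool
pt [] _ = false
pt (b ∷ x) zero = b
pt (b ∷ x) (suc m) = pt x m

mk : ∀ {n} → (ℕ → Bool) → V n
mk {zero} f = []
mk {suc n} f = f 0 ∷ mk (λ m → f (suc m))

pt-mk : ∀ {n} (f : ℕ → Bool) m → m < n → pt (mk {n} f) m ≡ f m
pt-mk {suc n} f zero h = refl
pt-mk {suc n} f (suc m) (s≤s h) = pt-mk (λ m → f (suc m)) m h

pt-⊕ : ∀ {n} (x y : V n) m → pt (x ⊕ y) m ≡ (pt x m xor pt y m)
pt-⊕ [] [] m = refl
pt-⊕ (a ∷ x) (b ∷ y) zero = refl
pt-⊕ (a ∷ x) (b ∷ y) (suc m) = pt-⊕ x y m

pt-𝟎 : ∀ {n} m → pt (𝟎 {n}) m ≡ false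
pt-𝟎 {zero} m = refl
pt-𝟎 {suc n} zero = refl
pt-𝟎 {suc n} (suc m) = pt-𝟎 {n} m

ext : ∀ {n} (x y : V n) → (∀ m → m < n → pt x m ≡ pt y m) → x ≡ y
ext [] [] h = refl
ext (a ∷ x) (b ∷ y) h = cong₂ _∷_ (h 0 (s≤s z≤n)) (ext x y (λ m lt → h (suc m) (s≤s lt)))

tabulate-mk : ∀ {n} (g : ℕ → Bool) → tabulate {n} (λ j → g (toℕ j)) ≡ mk g
tabulate-mk {zero} g = refl
tabulate-mk {suc n} g = cong (g 0 ∷_) (tabulate-mk {n} (λ m → g (suc m)))

mk-cong : ∀ {n} {f g : ℕ → Bool} → (∀ m → f m ≡ g m) → mk {n} f ≡ mk g
mk-cong {zero} h = refl
mk-cong {suc n} h = cong₂ _∷_ (h 0) (mk-cong (λ m → h (suc m)))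

mk-false : ∀ {n} → mk {n} (λ _ → false) ≡ 𝟎
mk-false {zero} = refl
mk-false {suc n} = cong (false ∷_) (mk-false {n})

-- A decision procedure for identities in the elementary abelian 2-group
-- (V n, ⊕): an identity between ⊕-terms holds iff it holds coordinatewise,
-- i.e. iff it holds for every Boolean assignment, which is checked by
-- evaluating all 2^k assignments.

infixl 6 _⊹_
data Tm (k : ℕ) : Set where
  v : Fin k → Tm k
  _⊹_ : Tm k → Tm k → Tm k
  o : Tm k

evB : ∀ {k} → (Fin k → Bool) → Tm k → Bool
evB β (v i) = β i
evB β (a ⊹ b) = evB β a xor evB β b
evB β o = false

evV : ∀ {k n} → (Fin k → V n) → Tm k → V n
evV ρ (v i) = ρ i
evV ρ (a ⊹ b) = evV ρ a ⊕ evV ρ b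
evV ρ o = 𝟎

pt-ev : ∀ {k n} (ρ : Fin k → V n) e m → pt (evV ρ e) m ≡ evB (λ i → pt (ρ i) m) e
pt-ev ρ (v i) m = refl
pt-ev ρ (a ⊹ b) m = trans (pt-⊕ (evV ρ a) (evV ρ b) m) (cong₂ _xor_ (pt-ev ρ a m) (pt-ev ρ b m))
pt-ev {n = n} ρ o m = pt-𝟎 {n} m

evB-cong : ∀ {k} {β β' : Fin k → Bool} → (∀ i → β i ≡ β' i) → ∀ e → evB β e ≡ evB β' e
evB-cong h (v i) = h i
evB-cong h (a ⊹ b) = cong₂ _xor_ (evB-cong h a) (evB-cong h b)
evB-cong h o = refl

cons : ∀ {k} → Bool → (Fin k → Bool) → Fin (suc k) → Bool
cons b β fz = b
cons b β (fs i) = β i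

allB : (k : ℕ) → ((Fin k → Bool) → Bool) → Bool
allB zero P = P (λ ())
allB (suc k) P = allB k (λ β → P (cons true β)) ∧ allB k (λ β → P (cons false β))

∧-l : ∀ {a b} → (a ∧ b) ≡ true → a ≡ true
∧-l {true} h = refl

∧-r : ∀ {a b} → (a ∧ b) ≡ true → b ≡ true
∧-r {true} h = h

Respects : ∀ {k} → ((Fin k → Bool) → Bool) → Set
Respects {k} P = ∀ β β' → (∀ i → β i ≡ β' i) → P β ≡ P β'

allB-sound : ∀ k (P : (Fin k → Bool) → Bool) → Respects P → allB k P ≡ true → ∀ β → P β ≡ true
allB-sound zero P r h β = trans (r β (λ ()) (λ ())) h
allB-sound (suc k) P r h β with β fz in e
... | true = trans (r β (cons true (λ i → β (fs i))) split)
               (allB-sound k (λ β → P (cons true β)) (λ b b' hh → r _ _ (λ { fz → refl ; (fs i) → hh i }))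
                 (∧-l h) (λ i → β (fs i)))
  where split : ∀ i → β i ≡ cons true (λ i → β (fs i)) i
        split fz = e
        split (fs i) = refl
... | false = trans (r β (cons false (λ i → β (fs i))) split)
                (allB-sound k (λ β → P (cons false β)) (λ b b' hh → r _ _ (λ { fz → refl ; (fs i) → hh i }))
                  (∧-r {allB k (λ β → P (cons true β))} h) (λ i → β (fs i)))
  where split : ∀ i → β i ≡ cons false (λ i → β (fs i)) i
        split fz = e
        split (fs i) = refl

beq : Bool → Bool → Bool
beq true true = true
beq false false = true
beq _ _ = false

beq→ : ∀ a b → beq a b ≡ true → a ≡ b
beq→ true true h = refl
beq→ false false h = refl

-- solve e₁ e₂ refl ρ : the identity e₁ = e₂ at the vectors ρ, once the truth
-- table check (the refl argument) succeeds by evaluation.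
solve : ∀ {k n} (e1 e2 : Tm k) → allB k (λ β → beq (evB β e1) (evB β e2)) ≡ true →
        (ρ : Fin k → V n) → evV ρ e1 ≡ evV ρ e2
solve {k} e1 e2 h ρ = ext _ _ λ m lt →
  trans (pt-ev ρ e1 m)
    (trans (beq→ _ _ (allB-sound k _ (λ β β' hh → cong₂ beq (evB-cong hh e1) (evB-cong hh e2)) h
                        (λ i → pt (ρ i) m)))
           (sym (pt-ev ρ e2 m)))

x0 : ∀ {k} → Tm (suc k)
x0 = v fz
x1 : ∀ {k} → Tm (suc (suc k))
x1 = v (fs fz)
x2 : ∀ {k} → Tm (suc (suc (suc k)))
x2 = v (fs (fs fz))
x3 : ∀ {k} → Tm (suc (suc (suc (suc k))))
x3 = v (fs (fs (fs fz)))
x4 : ∀ {k} → Tm (suc (suc (suc (suc (suc k)))))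
x4 = v (fs (fs (fs (fs fz))))

⊕-comm : ∀ {n} (a b : V n) → a ⊕ b ≡ b ⊕ a
⊕-comm a b = solve (x0 ⊹ x1) (x1 ⊹ x0) refl (lookup (a ∷ b ∷ []))

⊕-assoc : ∀ {n} (a b c : V n) → (a ⊕ b) ⊕ c ≡ a ⊕ (b ⊕ c)
⊕-assoc a b c = solve ((x0 ⊹ x1) ⊹ x2) (x0 ⊹ (x1 ⊹ x2)) refl (lookup (a ∷ b ∷ c ∷ []))

⊕-idl : ∀ {n} (a : V n) → 𝟎 ⊕ a ≡ a
⊕-idl a = solve (o ⊹ x0) x0 refl (lookup (a ∷ []))

⊕-idr : ∀ {n} (a : V n) → a ⊕ 𝟎 ≡ a
⊕-idr a = solve (x0 ⊹ o) x0 refl (lookup (a ∷ []))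

⊕-cancelʳ : ∀ {n} (y a : V n) → (y ⊕ a) ⊕ a ≡ y
⊕-cancelʳ y a = solve ((x0 ⊹ x1) ⊹ x1) x0 refl (lookup (y ∷ a ∷ []))

⊕-cancelˡ : ∀ {n} (a y : V n) → a ⊕ (a ⊕ y) ≡ y
⊕-cancelˡ a y = solve (x0 ⊹ (x0 ⊹ x1)) x1 refl (lookup (a ∷ y ∷ []))

⊕-shift : ∀ {n} (p A B C : V n) → p ⊕ C ≡ (p ⊕ A) ⊕ B → C ≡ B ⊕ A
⊕-shift p A B C e = begin
  C                 ≡⟨ sym (⊕-cancelˡ p C) ⟩
  p ⊕ (p ⊕ C)       ≡⟨ cong (p ⊕_) e ⟩
  p ⊕ ((p ⊕ A) ⊕ B) ≡⟨ solve (x0 ⊹ ((x0 ⊹ x1) ⊹ x2)) (x2 ⊹ x1) refl (lookup (p ∷ A ∷ B ∷ [])) ⟩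
  B ⊕ A             ∎

U : ∀ {n} → ℕ → V n
U p = mk (eq p)

F : ∀ {n} → ℕ → V n
F t = mk (ge t)

tailOnes≡F : ∀ {n} k → tailOnes {n} k ≡ F (n ∸ k)
tailOnes≡F {n} k = trans (tabulate-mk (λ m → (n ∸ k) ≤ᵇ m)) (mk-cong (λ m → sym (ge≡≤ᵇ (n ∸ k) m)))

unit≡U : ∀ {n} (i : Fin n) → unit i ≡ U (toℕ i)
unit≡U i = trans (tabulate-cong same) (tabulate-mk (eq (toℕ i)))
  where
  same : ∀ j → ⌊ i Data.Fin.≟ j ⌋ ≡ eq (toℕ i) (toℕ j)
  same j with i Data.Fin.≟ j
  ... | yes refl = sym (eq-refl (toℕ i))
  ... | no i≢j = sym (eq-no (λ e → i≢j (toℕ-injective e)))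

U≡F⊕F : ∀ {n} t → U {n} t ≡ F t ⊕ F (suc t)
U≡F⊕F {n} t = ext _ _ λ m lt →
  begin
    pt (U {n} t) m                     ≡⟨ pt-mk (eq t) m lt ⟩
    eq t m                             ≡⟨ sym (ge-window t m) ⟩
    ge t m xor ge (suc t) m            ≡⟨ sym (cong₂ _xor_ (pt-mk (ge t) m lt) (pt-mk (ge (suc t)) m lt)) ⟩
    pt (F {n} t) m xor pt (F {n} (suc t)) m ≡⟨ sym (pt-⊕ (F {n} t) (F (suc t)) m) ⟩
    pt (F {n} t ⊕ F (suc t)) m         ∎

F-beyond : ∀ {n} t → n ≤ t → F {n} t ≡ 𝟎
F-beyond {n} t n≤t = ext _ _ λ m m<n →
  trans (pt-mk (ge t) m m<n) (trans (ge-no (<-≤-trans m<n n≤t)) (sym (pt-𝟎 {n} m)))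

U-last : ∀ {n} t → n ≤ suc t → U {n} t ≡ F t
U-last t n≤t+1 = trans (U≡F⊕F t) (trans (cong (F t ⊕_) (F-beyond (suc t) n≤t+1)) (⊕-idr (F t)))

two-units≡gap-two : ∀ {n} t → U {n} t ⊕ U (suc t) ≡ F t ⊕ F (suc (suc t))
two-units≡gap-two t = trans (cong₂ _⊕_ (U≡F⊕F t) (U≡F⊕F (suc t)))
  (solve ((x0 ⊹ x1) ⊹ (x1 ⊹ x2)) (x0 ⊹ x2) refl (lookup (F t ∷ F (suc t) ∷ F (suc (suc t)) ∷ [])))

-- S in normal form: a unit vector U p (p < n) or a tail F r with at least
-- two ones (r + 1 < n).
SForm : ∀ {n} → V n → Set
SForm {n} x = (Σ ℕ λ p → p < n × x ≡ U p) ⊎ (Σ ℕ λ r → suc r < n × x ≡ F r)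

two≤n∸r : ∀ r n → suc r < n → 2 ≤ n ∸ r
two≤n∸r zero n h = h
two≤n∸r (suc r) (suc n) (s≤s h) = two≤n∸r r n h

tail-start< : ∀ k n → 2 ≤ k → k ≤ n → suc (n ∸ k) < n
tail-start< (suc (suc k)) (suc (suc n)) (s≤s (s≤s _)) (s≤s (s≤s h)) = s≤s (s≤s (m∸n≤m n k))

SForm⇒InS : ∀ {n} {x : V n} → SForm x → InS x
SForm⇒InS (inj₁ (p , p<n , refl)) =
  subst InS (trans (unit≡U (fromℕ< p<n)) (cong U (toℕ-fromℕ< p<n))) (unitS (fromℕ< p<n))
SForm⇒InS {n} (inj₂ (r , r+1<n , refl)) =
  subst InS (trans (tailOnes≡F (n ∸ r)) (cong F (m∸[m∸n]≡n (<⇒≤ (≤-trans (s≤s (n≤1+n r)) r+1<n)))))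
    (tailS (n ∸ r) (two≤n∸r r n r+1<n) (m∸n≤m n r))

InS⇒SForm : ∀ {n} {x : V n} → InS x → SForm x
InS⇒SForm (unitS i) = inj₁ (toℕ i , toℕ<n i , unit≡U i)
InS⇒SForm {n} (tailS k 2≤k k≤n) = inj₂ (n ∸ k , tail-start< k n 2≤k k≤n , tailOnes≡F k)

U∈S : ∀ {n} p → p < n → InS (U {n} p)
U∈S p p<n = SForm⇒InS (inj₁ (p , p<n , refl))

-- Every nonzero tail lies in S (the last one is a unit vector).
F∈S : ∀ {n} t → t < n → InS (F {n} t)
F∈S {n} t t<n with suc t <? n
... | yes t+1<n = SForm⇒InS (inj₂ (t , t+1<n , refl))
... | no t+1≮n = subst InS (U-last t (≮⇒≥ t+1≮n)) (U∈S t t<n)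

S-difference⇒adjacent : ∀ {n} {u w : V n} → InS (w ⊕ u) → Adj u w
S-difference⇒adjacent {u = u} {w} S = w ⊕ u , S , sym (⊕-cancelʳ w u)

adjacent⇒S-difference : ∀ {n} {u w : V n} → Adj u w → InS (w ⊕ u)
adjacent⇒S-difference {u = u} (s , Ss , refl) = subst InS (sym (⊕-cancelʳ s u)) Ss

unit-induction : ∀ {n} (R : V n → Set) → R 𝟎 → (∀ x p → p < n → R x → R (U p ⊕ x)) → ∀ x → R x
unit-induction {zero} R r0 step [] = r0
unit-induction {suc n} R r0 step (b ∷ x) = head b
  where
  R' : V n → Set
  R' y = R (false ∷ y)
  tail-case : ∀ y → R' y
  tail-case = unit-induction R' r0 (λ y p p<n Ry → step (false ∷ y) (suc p) (s≤s p<n) Ry)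
  head : ∀ b → R (b ∷ x)
  head false = tail-case x
  head true = subst (λ w → R (true ∷ w)) (trans (cong (_⊕ x) (mk-false {n})) (⊕-idl x))
                (step (false ∷ x) 0 (s≤s z≤n) (tail-case x))

tail-induction : ∀ {n} (R : V n → Set) → R 𝟎 → (∀ x t → t < n → R x → R (x ⊕ F t)) → ∀ x → R x
tail-induction {n} R r0 step = unit-induction R r0 add-unit
  where
  add-tail : ∀ y t → R y → R (y ⊕ F t)
  add-tail y t Ry with t <? n
  ... | yes t<n = step y t t<n Ry
  ... | no t≮n = subst R (sym (trans (cong (y ⊕_) (F-beyond t (≮⇒≥ t≮n))) (⊕-idr y))) Ry
  unit-as-tails : ∀ p x → (x ⊕ F p) ⊕ F (suc p) ≡ U p ⊕ x
  unit-as-tails p x = trans (solve ((x0 ⊹ x1) ⊹ x2) ((x1 ⊹ x2) ⊹ x0) refl (lookup (x ∷ F p ∷ F (suc p) ∷ [])))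
                            (cong (_⊕ x) (sym (U≡F⊕F p)))
  add-unit : ∀ x p → p < n → R x → R (U p ⊕ x)
  add-unit x p _ Rx = subst R (unit-as-tails p x) (add-tail _ (suc p) (add-tail x p Rx))

-- An equation between ⊕-sums of U's and F's is
-- reduced to Boolean equations at chosen coordinates m via  at , which are
-- then evaluated with the ge/eq lemmas.  Throughout n = k + 2.

data Ex : Set where
  uu ff : ℕ → Ex
  _⊞_ : Ex → Ex → Ex

⟦_⟧ : ∀ {n} → Ex → V n
⟦ uu p ⟧ = U p
⟦ ff t ⟧ = F t
⟦ a ⊞ b ⟧ = ⟦ a ⟧ ⊕ ⟦ b ⟧

⟪_⟫ : Ex → ℕ → Bool
⟪ uu p ⟫ m = eq p m
⟪ ff t ⟫ m = ge t m
⟪ a ⊞ b ⟫ m = ⟪ a ⟫ m xor ⟪ b ⟫ m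

ptEx : ∀ {n} e m → m < n → pt (⟦_⟧ {n} e) m ≡ ⟪ e ⟫ m
ptEx (uu p) m lt = pt-mk (eq p) m lt
ptEx (ff t) m lt = pt-mk (ge t) m lt
ptEx (a ⊞ b) m lt = trans (pt-⊕ ⟦ a ⟧ ⟦ b ⟧ m) (cong₂ _xor_ (ptEx a m lt) (ptEx b m lt))

at : ∀ {n} e1 e2 → ⟦_⟧ {n} e1 ≡ ⟦ e2 ⟧ → ∀ m → m < n → ⟪ e1 ⟫ m ≡ ⟪ e2 ⟫ m
at e1 e2 E m lt = trans (sym (ptEx e1 m lt)) (trans (cong (λ x → pt x m) E) (ptEx e2 m lt))

unit-sum-distinct : ∀ t p q → ¬ p ≡ t → (eq t t xor eq p t) ≡ eq q t → (eq t p xor eq p p) ≡ eq q p → ⊥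
unit-sum-distinct t p q ne h1 h2 rewrite eq-refl t | eq-refl p | eq-no ne | eq-no (λ e → ne (sym e)) =
  ne (trans (sym (eq→ q p (sym h2))) (eq→ q t (sym h1)))

unit-sum-equal : ∀ t q → (eq t q xor eq t q) ≡ eq q q → ⊥
unit-sum-equal t q h rewrite xor-same (eq t q) | eq-refl q with () ← h

unit⊕unit∉units : ∀ {n} t p q → t < n → p < n → q < n → U {n} t ⊕ U p ≡ U q → ⊥
unit⊕unit∉units t p q lt lp lq E with p ≟ t
... | yes refl = unit-sum-equal t q (at (uu t ⊞ uu t) (uu q) E q lq)
... | no ne = unit-sum-distinct t p q ne (at (uu t ⊞ uu p) (uu q) E t lt) (at (uu t ⊞ uu p) (uu q) E p lp)

last<N : ∀ {k} → suc k < suc (suc k)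
last<N = ≤-refl
penult<N : ∀ {k} → k < suc (suc k)
penult<N {k} = s≤s (n≤1+n k)
≤k⇒<N : ∀ {t k} → t ≤ k → t < suc (suc k)
≤k⇒<N h = s≤s (m≤n⇒m≤1+n h)

-- Consecutive tails: c ∈ S and U t ⊕ c ∈ S force c ∈ {F t, F (t+1)}.
-- One lemma per shape (unit or tail) of c and of U t ⊕ c.

-- c = U p, U t ⊕ c = F r: coordinates k+1 and k force p = k+1 = t+1, so c = F (t+1).
consecutive-unit-tail : ∀ k t p r → t ≤ k → r ≤ k →
  (eq t (suc k) xor eq p (suc k)) ≡ ge r (suc k) → (eq t k xor eq p k) ≡ ge r k → p ≡ suc k × t ≡ k
consecutive-unit-tail k t p r tk rk h1 h2 rewrite eq-no {t} {suc k} (<⇒≢ (s≤s tk)) | ge-yes (m≤n⇒m≤1+n rk) | ge-yes rk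
  with eq→ p (suc k) h1
... | refl rewrite eq-no {suc k} {k} 1+n≢n | xor-identityʳ (eq t k) = refl , eq→ t k h2

-- c = F r, U t ⊕ c = U q: then r = t.
consecutive-tail-unit : ∀ k t r q → t ≤ k → r ≤ k →
  (eq t (suc k) xor ge r (suc k)) ≡ eq q (suc k) → (eq t k xor ge r k) ≡ eq q k →
  (∀ m → m < suc (suc k) → (eq t m xor ge r m) ≡ eq q m) → r ≡ t
consecutive-tail-unit k t r q tk rk h1 h2 hh rewrite eq-no {t} {suc k} (<⇒≢ (s≤s tk)) | ge-yes (m≤n⇒m≤1+n rk) | ge-yes rk
  with eq→ q (suc k) (sym h1)
... | refl rewrite eq-no {suc k} {k} 1+n≢n | xor-true (eq t k) with eq→ t k (not-false h2)
...   | refl with <-cmp r t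
...     | tri≈ _ e _ = e
...     | tri> _ _ c = ⊥-elim (<⇒≱ c rk)
...     | tri< c _ _ = ⊥-elim (clash (hh r (≤k⇒<N rk)))
  where clash : (eq t r xor ge r r) ≡ eq (suc t) r → ⊥
        clash h rewrite eq-no {t} {r} (λ e → <⇒≢ c (sym e)) | ge-yes (≤-refl {r}) | eq-no {suc t} {r} (λ e → <⇒≢ (≤-trans c (n≤1+n t)) (sym e)) with () ← h

-- c = F r, U t ⊕ c = F r': then r ∈ {t, t+1}.
consecutive-tail-tail : ∀ k t r r' → t ≤ k → r ≤ k →
  (∀ m → m < suc (suc k) → (eq t m xor ge r m) ≡ ge r' m) → r ≡ t ⊎ r ≡ suc t
consecutive-tail-tail k t r r' tk rk hh with <-cmp r t
... | tri≈ _ e _ = inj₁ e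
... | tri< c _ _ = ⊥-elim (clash (hh r (≤k⇒<N rk)) (hh t (≤k⇒<N tk)))
  where clash : (eq t r xor ge r r) ≡ ge r' r → (eq t t xor ge r t) ≡ ge r' t → ⊥
        clash h1 h2 rewrite eq-no {t} {r} (λ e → <⇒≢ c (sym e)) | ge-yes (≤-refl {r}) | eq-refl t | ge-yes (<⇒≤ c)
          | ge-yes (≤-trans (ge→ r' r (sym h1)) (<⇒≤ c)) with () ← h2
... | tri> _ _ c with r ≟ suc t
...   | yes e = inj₂ e
...   | no ne = ⊥-elim (clash (hh t (≤k⇒<N tk)) (hh (suc t) (≤k⇒<N (≤-trans (<⇒≤ c') rk))))
  where c' : suc t < r
        c' = ≤∧≢⇒< c (λ e → ne (sym e))
        clash : (eq t t xor ge r t) ≡ ge r' t → (eq t (suc t) xor ge r (suc t)) ≡ ge r' (suc t) → ⊥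
        clash h1 h2 rewrite eq-refl t | ge-no c | eq-no {t} {suc t} (<⇒≢ ≤-refl) | ge-no c'
          | ge-yes (m≤n⇒m≤1+n (ge→ r' t (sym h1))) with () ← h2

consecutive-forms : ∀ {k} t → t ≤ k → (c : V (suc (suc k))) → SForm c → SForm (U t ⊕ c) → c ≡ F t ⊎ c ≡ F (suc t)
consecutive-forms t tk c (inj₁ (p , lp , refl)) (inj₁ (q , lq , E)) = ⊥-elim (unit⊕unit∉units t p q (≤k⇒<N tk) lp lq E)
consecutive-forms {k} t tk c (inj₁ (p , lp , refl)) (inj₂ (r , s≤s (s≤s rk) , E))
  with consecutive-unit-tail k t p r tk rk (at (uu t ⊞ uu p) (ff r) E (suc k) last<N) (at (uu t ⊞ uu p) (ff r) E k penult<N)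
... | refl , refl = inj₂ (U-last (suc k) ≤-refl)
consecutive-forms {k} t tk c (inj₂ (r , s≤s (s≤s rk) , refl)) (inj₁ (q , lq , E)) =
  inj₁ (cong F (consecutive-tail-unit k t r q tk rk (at (uu t ⊞ ff r) (uu q) E (suc k) last<N) (at (uu t ⊞ ff r) (uu q) E k penult<N)
                   (at (uu t ⊞ ff r) (uu q) E)))
consecutive-forms {k} t tk c (inj₂ (r , s≤s (s≤s rk) , refl)) (inj₂ (r' , lr' , E))
  with consecutive-tail-tail k t r r' tk rk (at (uu t ⊞ ff r) (ff r') E)
... | inj₁ e = inj₁ (cong F e)
... | inj₂ e = inj₂ (cong F e)

-- Distant tails (s ≥ t+3): c ∈ S and F t ⊕ F s ⊕ c ∈ S force c ∈ {F t, F s}.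
-- On the block t ≤ m < s of at least three coordinates, F t ⊕ F s ⊕ U p
-- agrees with U q off p, which is impossible for a single q.

distant-unit-coordinate : ∀ t s p q m → t ≤ m → m < s → ¬ p ≡ m → ((ge t m xor ge s m) xor eq p m) ≡ eq q m → q ≡ m
distant-unit-coordinate t s p q m tm ms pm h rewrite ge-yes tm | ge-no ms | eq-no pm = eq→ q m (sym h)

distinct-values : ∀ {q a b} → a < b → q ≡ a → q ≡ b → ⊥
distinct-values lt e1 e2 = <⇒≢ lt (trans (sym e1) e2)

-- Three block coordinates t, t+1, t+2 but only one p: q would equal two of them.
distant-unit-unit : ∀ {k} t s p q → suc (suc (suc t)) ≤ s → s ≤ suc k →
  (∀ m → m < suc (suc k) → ((ge t m xor ge s m) xor eq p m) ≡ eq q m) → ⊥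
distant-unit-unit {k} t s p q t+3≤s s≤k+1 hh = cases (p ≟ t) (p ≟ suc t)
  where
  t+1<s : suc t < s
  t+1<s = ≤-trans (n≤1+n _) t+3≤s
  t<s : t < s
  t<s = ≤-trans (n≤1+n _) t+1<s
  t≤t+2 : t ≤ suc (suc t)
  t≤t+2 = ≤-trans (n≤1+n t) (n≤1+n (suc t))
  block : ∀ m → t ≤ m → m < s → ¬ p ≡ m → q ≡ m
  block m t≤m m<s p≢m = distant-unit-coordinate t s p q m t≤m m<s p≢m (hh m (≤-trans m<s (m≤n⇒m≤1+n s≤k+1)))
  apart : ∀ {a b} → p ≡ a → a < b → ¬ p ≡ b
  apart {a} p≡a a<b p≡b = <⇒≢ a<b (trans (sym p≡a) p≡b)
  cases : Dec (p ≡ t) → Dec (p ≡ suc t) → ⊥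
  cases (yes p≡t) _ = distinct-values ≤-refl
    (block (suc t) (n≤1+n t) t+1<s (apart p≡t ≤-refl))
    (block (suc (suc t)) t≤t+2 t+3≤s (apart p≡t (s≤s (n≤1+n t))))
  cases (no _) (yes p≡t+1) = distinct-values (s≤s (n≤1+n t))
    (block t ≤-refl t<s (λ p≡t → 1+n≢n (trans (sym p≡t+1) p≡t)))
    (block (suc (suc t)) t≤t+2 t+3≤s (apart p≡t+1 ≤-refl))
  cases (no p≢t) (no p≢t+1) = distinct-values ≤-refl
    (block t ≤-refl t<s p≢t) (block (suc t) (n≤1+n t) t+1<s p≢t+1)

-- c = U p, result F r: p = k+1 = s, so c = F s.
distant-unit-tail : ∀ k t s p r → t ≤ k → s ≤ suc k → r ≤ k →
  ((ge t (suc k) xor ge s (suc k)) xor eq p (suc k)) ≡ ge r (suc k) →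
  ((ge t k xor ge s k) xor eq p k) ≡ ge r k → p ≡ suc k × s ≡ suc k
distant-unit-tail k t s p r tk sk rk h1 h2 rewrite ge-yes (m≤n⇒m≤1+n tk) | ge-yes sk | ge-yes (m≤n⇒m≤1+n rk)
  with eq→ p (suc k) h1
... | refl rewrite ge-yes tk | eq-no {suc k} {k} 1+n≢n | ge-yes rk | xor-identityʳ (not (ge s k)) =
  refl , ≤-antisym sk (ge→' s k (not-true h2))

-- c = F r, result U q: then r = t.
distant-tail-unit : ∀ k t s r q → t ≤ k → s ≤ suc k → r ≤ k → t < s →
  (∀ m → m < suc (suc k) → ((ge t m xor ge s m) xor ge r m) ≡ eq q m) → r ≡ t
distant-tail-unit k t s r q tk sk rk ts hh = go (hh (suc k) last<N)
  where
  go : ((ge t (suc k) xor ge s (suc k)) xor ge r (suc k)) ≡ eq q (suc k) → r ≡ t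
  go h1 rewrite ge-yes (m≤n⇒m≤1+n tk) | ge-yes sk | ge-yes (m≤n⇒m≤1+n rk) with eq→ q (suc k) (sym h1)
  ... | refl with <-cmp r t
  ...   | tri≈ _ e _ = e
  ...   | tri< c _ _ = ⊥-elim (clash (hh r (≤k⇒<N rk)))
    where clash : ((ge t r xor ge s r) xor ge r r) ≡ eq (suc k) r → ⊥
          clash h rewrite ge-no c | ge-no (<-trans c ts) | ge-yes (≤-refl {r}) | eq-no {suc k} {r} (λ e → <⇒≱ (s≤s rk) (≤-reflexive e)) with () ← h
  ...   | tri> _ _ c = ⊥-elim (clash (hh t (≤k⇒<N tk)))
    where clash : ((ge t t xor ge s t) xor ge r t) ≡ eq (suc k) t → ⊥
          clash h rewrite ge-yes (≤-refl {t}) | ge-no ts | ge-no c | eq-no {suc k} {t} (λ e → <⇒≱ (s≤s tk) (≤-reflexive e)) with () ← h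

-- c = F r, result F r': then r ∈ {t, s}.
distant-tail-tail : ∀ k t s r r' → t ≤ k → s ≤ suc k → r ≤ k → t < s →
  (∀ m → m < suc (suc k) → ((ge t m xor ge s m) xor ge r m) ≡ ge r' m) → r ≡ t ⊎ r ≡ s
distant-tail-tail k t s r r' tk sk rk ts hh with <-cmp r t
... | tri≈ _ e _ = inj₁ e
... | tri< c _ _ = ⊥-elim (clash (hh r (≤k⇒<N rk)) (hh t (≤k⇒<N tk)))
  where clash : ((ge t r xor ge s r) xor ge r r) ≡ ge r' r → ((ge t t xor ge s t) xor ge r t) ≡ ge r' t → ⊥
        clash h1 h2 rewrite ge-no c | ge-no (<-trans c ts) | ge-yes (≤-refl {r}) | ge-yes (≤-refl {t}) | ge-no ts | ge-yes (<⇒≤ c)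
          | ge-yes (≤-trans (ge→ r' r (sym h1)) (<⇒≤ c)) with () ← h2
... | tri> _ _ c with <-cmp r s
...   | tri≈ _ e _ = inj₂ e
...   | tri< d _ _ = ⊥-elim (clash (hh t (≤k⇒<N tk)) (hh r (≤k⇒<N rk)))
  where clash : ((ge t t xor ge s t) xor ge r t) ≡ ge r' t → ((ge t r xor ge s r) xor ge r r) ≡ ge r' r → ⊥
        clash h1 h2 rewrite ge-yes (≤-refl {t}) | ge-no ts | ge-no c | ge-yes (<⇒≤ c) | ge-no d | ge-yes (≤-refl {r})
          | ge-yes (≤-trans (ge→ r' t (sym h1)) (<⇒≤ c)) with () ← h2
...   | tri> _ _ d = ⊥-elim (clash (hh t (≤k⇒<N tk)) (hh s sk'))
  where sk' : s < suc (suc k)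
        sk' = s≤s sk
        clash : ((ge t t xor ge s t) xor ge r t) ≡ ge r' t → ((ge t s xor ge s s) xor ge r s) ≡ ge r' s → ⊥
        clash h1 h2 rewrite ge-yes (≤-refl {t}) | ge-no ts | ge-no c | ge-yes (<⇒≤ ts) | ge-yes (≤-refl {s}) | ge-no d
          | ge-yes (≤-trans (ge→ r' t (sym h1)) (<⇒≤ ts)) with () ← h2

distant-forms : ∀ {k} t s → suc (suc (suc t)) ≤ s → s ≤ suc k → (c : V (suc (suc k))) → SForm c → SForm ((F t ⊕ F s) ⊕ c) → c ≡ F t ⊎ c ≡ F s
distant-forms {k} t s ts sk c (inj₁ (p , lp , refl)) (inj₁ (q , lq , E)) = ⊥-elim (distant-unit-unit t s p q ts sk (at ((ff t ⊞ ff s) ⊞ uu p) (uu q) E))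
distant-forms {k} t s ts sk c (inj₁ (p , lp , refl)) (inj₂ (r , s≤s (s≤s rk) , E))
  with distant-unit-tail k t s p r tk sk rk (at ((ff t ⊞ ff s) ⊞ uu p) (ff r) E (suc k) last<N) (at ((ff t ⊞ ff s) ⊞ uu p) (ff r) E k penult<N)
  where tk : t ≤ k
        tk = ≤-trans (n≤1+n t) (≤-trans (n≤1+n _) (≤-pred (≤-trans ts sk)))
... | refl , refl = inj₂ (U-last (suc k) ≤-refl)
distant-forms {k} t s ts sk c (inj₂ (r , s≤s (s≤s rk) , refl)) (inj₁ (q , lq , E)) =
  inj₁ (cong F (distant-tail-unit k t s r q tk sk rk ts' (at ((ff t ⊞ ff s) ⊞ ff r) (uu q) E)))
  where tk : t ≤ k
        tk = ≤-trans (n≤1+n t) (≤-trans (n≤1+n _) (≤-pred (≤-trans ts sk)))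
        ts' : t < s
        ts' = ≤-trans (n≤1+n _) (≤-trans (n≤1+n _) ts)
distant-forms {k} t s ts sk c (inj₂ (r , s≤s (s≤s rk) , refl)) (inj₂ (r' , _ , E))
  with distant-tail-tail k t s r r' tk sk rk ts' (at ((ff t ⊞ ff s) ⊞ ff r) (ff r') E)
  where tk : t ≤ k
        tk = ≤-trans (n≤1+n t) (≤-trans (n≤1+n _) (≤-pred (≤-trans ts sk)))
        ts' : t < s
        ts' = ≤-trans (n≤1+n _) (≤-trans (n≤1+n _) ts)
... | inj₁ e = inj₁ (cong F e)
... | inj₂ e = inj₂ (cong F e)

-- Tails at distance two: F t ⊕ F (t+2) = U t ⊕ U (t+1), and c ∈ S with
-- U t ⊕ U (t+1) ⊕ c ∈ S forces c ∈ {F t, F (t+2), U t, U (t+1)}.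

-- c = U p with p ∉ {t, t+1}, result U q: q would equal both t and t+1.
gap-two-unit-unit : ∀ t p q → ¬ p ≡ t → ¬ p ≡ suc t →
  ((eq t t xor eq (suc t) t) xor eq p t) ≡ eq q t →
  ((eq t (suc t) xor eq (suc t) (suc t)) xor eq p (suc t)) ≡ eq q (suc t) → ⊥
gap-two-unit-unit t p q n1 n2 h1 h2 rewrite eq-refl t | eq-no {suc t} {t} 1+n≢n | eq-no n1 | eq-no {t} {suc t} (<⇒≢ ≤-refl) | eq-no n2 =
  distinct-values ≤-refl (eq→ q t (sym h1)) (eq→ q (suc t) (sym h2))

-- c = U p, result F r: p = k+1 = t+2, so c = F (t+2).
gap-two-unit-tail : ∀ k t p r → suc t ≤ k → r ≤ k →
  ((eq t (suc k) xor eq (suc t) (suc k)) xor eq p (suc k)) ≡ ge r (suc k) →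
  ((eq t k xor eq (suc t) k) xor eq p k) ≡ ge r k → p ≡ suc k × k ≡ suc t
gap-two-unit-tail k t p r tk rk h1 h2 rewrite eq-no {t} {suc k} (<⇒≢ (≤-trans (n≤1+n _) (s≤s tk))) | eq-no {suc t} {suc k} (<⇒≢ (s≤s tk)) | ge-yes (m≤n⇒m≤1+n rk)
  with eq→ p (suc k) h1
... | refl rewrite eq-no {suc k} {k} 1+n≢n | ge-yes rk | xor-identityʳ (eq (suc t) k) = refl , sym (eq→ (suc t) k h2)

-- c = F r, result U q: then r = t.
gap-two-tail-unit : ∀ k t r q → suc t ≤ k → r ≤ k →
  (∀ m → m < suc (suc k) → ((eq t m xor eq (suc t) m) xor ge r m) ≡ eq q m) → r ≡ t
gap-two-tail-unit k t r q tk rk hh = go (hh (suc k) last<N)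
  where
  go : ((eq t (suc k) xor eq (suc t) (suc k)) xor ge r (suc k)) ≡ eq q (suc k) → r ≡ t
  go h1 rewrite eq-no {t} {suc k} (<⇒≢ (≤-trans (n≤1+n _) (s≤s tk))) | eq-no {suc t} {suc k} (<⇒≢ (s≤s tk)) | ge-yes (m≤n⇒m≤1+n rk)
    with eq→ q (suc k) (sym h1)
  ... | refl with <-cmp r t
  ...   | tri≈ _ e _ = e
  ...   | tri< c _ _ = ⊥-elim (clash (hh r (≤k⇒<N rk)))
    where clash : ((eq t r xor eq (suc t) r) xor ge r r) ≡ eq (suc k) r → ⊥
          clash h rewrite eq-no {t} {r} (λ e → <⇒≢ c (sym e)) | eq-no {suc t} {r} (λ e → <⇒≢ (≤-trans c (n≤1+n t)) (sym e)) | ge-yes (≤-refl {r})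
            | eq-no {suc k} {r} (λ e → <⇒≱ (s≤s rk) (≤-reflexive e)) with () ← h
  ...   | tri> _ _ c = ⊥-elim (clash (hh t (≤k⇒<N (≤-trans (n≤1+n t) tk))))
    where clash : ((eq t t xor eq (suc t) t) xor ge r t) ≡ eq (suc k) t → ⊥
          clash h rewrite eq-refl t | eq-no {suc t} {t} 1+n≢n | ge-no c
            | eq-no {suc k} {t} (λ e → <⇒≱ (s≤s (≤-trans (n≤1+n t) tk)) (≤-reflexive e)) with () ← h

-- c = F r, result F r': then r ∈ {t, t+2}.
gap-two-tail-tail : ∀ k t r r' → suc t ≤ k → r ≤ k →
  (∀ m → m < suc (suc k) → ((eq t m xor eq (suc t) m) xor ge r m) ≡ ge r' m) → r ≡ t ⊎ r ≡ suc (suc t)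
gap-two-tail-tail k t r r' tk rk hh with <-cmp r t
... | tri≈ _ e _ = inj₁ e
... | tri< c _ _ = ⊥-elim (clash (hh r (≤k⇒<N rk)) (hh t (≤k⇒<N (≤-trans (n≤1+n t) tk))))
  where clash : ((eq t r xor eq (suc t) r) xor ge r r) ≡ ge r' r → ((eq t t xor eq (suc t) t) xor ge r t) ≡ ge r' t → ⊥
        clash h1 h2 rewrite eq-no {t} {r} (λ e → <⇒≢ c (sym e)) | eq-no {suc t} {r} (λ e → <⇒≢ (≤-trans c (n≤1+n t)) (sym e)) | ge-yes (≤-refl {r})
          | eq-refl t | eq-no {suc t} {t} 1+n≢n | ge-yes (<⇒≤ c) | ge-yes (≤-trans (ge→ r' r (sym h1)) (<⇒≤ c)) with () ← h2
... | tri> _ _ c with r ≟ suc t | r ≟ suc (suc t)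
...   | yes refl | _ = ⊥-elim (clash (hh t (≤k⇒<N (≤-trans (n≤1+n t) tk))) (hh (suc t) (≤k⇒<N tk)))
  where clash : ((eq t t xor eq (suc t) t) xor ge (suc t) t) ≡ ge r' t → ((eq t (suc t) xor eq (suc t) (suc t)) xor ge (suc t) (suc t)) ≡ ge r' (suc t) → ⊥
        clash h1 h2 rewrite eq-refl t | eq-no {suc t} {t} 1+n≢n | ge-no {suc t} {t} ≤-refl | eq-no {t} {suc t} (<⇒≢ ≤-refl)
          | ge-yes (≤-refl {suc t}) | ge-yes (≤-trans (ge→ r' t (sym h1)) (n≤1+n t)) with () ← h2
...   | no _ | yes e = inj₂ e
...   | no n1 | no n2 = ⊥-elim (clash (hh t (≤k⇒<N (≤-trans (n≤1+n t) tk))) (hh (suc (suc t)) (≤k⇒<N (≤-trans (<⇒≤ c2) rk))))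
  where c1 : suc t < r
        c1 = ≤∧≢⇒< c (λ e → n1 (sym e))
        c2 : suc (suc t) < r
        c2 = ≤∧≢⇒< c1 (λ e → n2 (sym e))
        clash : ((eq t t xor eq (suc t) t) xor ge r t) ≡ ge r' t → ((eq t (suc (suc t)) xor eq (suc t) (suc (suc t))) xor ge r (suc (suc t))) ≡ ge r' (suc (suc t)) → ⊥
        clash h1 h2 rewrite eq-refl t | eq-no {suc t} {t} 1+n≢n | ge-no c | eq-no {t} {suc (suc t)} (<⇒≢ (≤-trans (n≤1+n _) ≤-refl))
          | eq-no {suc t} {suc (suc t)} (<⇒≢ ≤-refl) | ge-no c2 | ge-yes (≤-trans (ge→ r' t (sym h1)) (≤-trans (n≤1+n t) (n≤1+n (suc t)))) with () ← h2

gap-two-forms : ∀ {k} t → suc t ≤ k → (c : V (suc (suc k))) → SForm c → SForm ((U t ⊕ U (suc t)) ⊕ c) →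
  c ≡ F t ⊎ c ≡ F (suc (suc t)) ⊎ c ≡ U t ⊎ c ≡ U (suc t)
gap-two-forms {k} t tk c (inj₁ (p , lp , refl)) (inj₁ (q , lq , E)) with p ≟ t | p ≟ suc t
... | yes e | _ = inj₂ (inj₂ (inj₁ (cong U e)))
... | no _ | yes e = inj₂ (inj₂ (inj₂ (cong U e)))
... | no n1 | no n2 = ⊥-elim (gap-two-unit-unit t p q n1 n2 (at ((uu t ⊞ uu (suc t)) ⊞ uu p) (uu q) E t (≤k⇒<N (≤-trans (n≤1+n t) tk)))
                                                  (at ((uu t ⊞ uu (suc t)) ⊞ uu p) (uu q) E (suc t) (≤k⇒<N tk)))
gap-two-forms {k} t tk c (inj₁ (p , lp , refl)) (inj₂ (r , s≤s (s≤s rk) , E))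
  with gap-two-unit-tail k t p r tk rk (at ((uu t ⊞ uu (suc t)) ⊞ uu p) (ff r) E (suc k) last<N) (at ((uu t ⊞ uu (suc t)) ⊞ uu p) (ff r) E k penult<N)
... | refl , refl = inj₂ (inj₁ (U-last (suc k) ≤-refl))
gap-two-forms {k} t tk c (inj₂ (r , s≤s (s≤s rk) , refl)) (inj₁ (q , lq , E)) =
  inj₁ (cong F (gap-two-tail-unit k t r q tk rk (at ((uu t ⊞ uu (suc t)) ⊞ ff r) (uu q) E)))
gap-two-forms {k} t tk c (inj₂ (r , s≤s (s≤s rk) , refl)) (inj₂ (r' , _ , E)) with gap-two-tail-tail k t r r' tk rk (at ((uu t ⊞ uu (suc t)) ⊞ ff r) (ff r') E)
... | inj₁ e = inj₁ (cong F e)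
... | inj₂ e = inj₂ (inj₁ (cong F e))

two-units-not-form : ∀ {k} t → suc t ≤ k → SForm (U {suc (suc k)} t ⊕ U (suc t)) → ⊥
two-units-not-form {k} t tk (inj₁ (q , lq , E)) = clash (at (uu t ⊞ uu (suc t)) (uu q) E t (≤k⇒<N (≤-trans (n≤1+n t) tk))) (at (uu t ⊞ uu (suc t)) (uu q) E (suc t) (≤k⇒<N tk))
  where clash : (eq t t xor eq (suc t) t) ≡ eq q t → (eq t (suc t) xor eq (suc t) (suc t)) ≡ eq q (suc t) → ⊥
        clash h1 h2 rewrite eq-refl t | eq-no {suc t} {t} 1+n≢n | eq-no {t} {suc t} (<⇒≢ ≤-refl) =
          distinct-values ≤-refl (eq→ q t (sym h1)) (eq→ q (suc t) (sym h2))
two-units-not-form {k} t tk (inj₂ (r , s≤s (s≤s rk) , E)) = clash (at (uu t ⊞ uu (suc t)) (ff r) E (suc k) last<N)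
  where clash : (eq t (suc k) xor eq (suc t) (suc k)) ≡ ge r (suc k) → ⊥
        clash h rewrite eq-no {t} {suc k} (<⇒≢ (≤-trans (n≤1+n _) (s≤s tk))) | eq-no {suc t} {suc k} (<⇒≢ (s≤s tk)) | ge-yes (m≤n⇒m≤1+n rk) with () ← h

unit+gap-tail-not-form : ∀ {k} p → suc p ≤ k → SForm (U {suc (suc k)} p ⊕ F (suc (suc p))) → ⊥
unit+gap-tail-not-form {k} p pk (inj₁ (q , lq , E)) = clash (at (uu p ⊞ ff (suc (suc p))) (uu q) E p (≤k⇒<N (≤-trans (n≤1+n p) pk))) (at (uu p ⊞ ff (suc (suc p))) (uu q) E (suc k) last<N)
  where clash : (eq p p xor ge (suc (suc p)) p) ≡ eq q p → (eq p (suc k) xor ge (suc (suc p)) (suc k)) ≡ eq q (suc k) → ⊥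
        clash h1 h2 rewrite eq-refl p | ge-no {suc (suc p)} {p} (≤-trans (n≤1+n _) ≤-refl) with eq→ q p (sym h1)
        ... | refl rewrite eq-no {q} {suc k} (<⇒≢ (≤-trans (n≤1+n _) (s≤s pk))) | ge-yes {suc (suc q)} {suc k} (s≤s pk) with () ← h2
unit+gap-tail-not-form {k} p pk (inj₂ (r , s≤s (s≤s rk) , E)) = clash (at (uu p ⊞ ff (suc (suc p))) (ff r) E p (≤k⇒<N (≤-trans (n≤1+n p) pk))) (at (uu p ⊞ ff (suc (suc p))) (ff r) E (suc p) (≤k⇒<N pk))
  where clash : (eq p p xor ge (suc (suc p)) p) ≡ ge r p → (eq p (suc p) xor ge (suc (suc p)) (suc p)) ≡ ge r (suc p) → ⊥
        clash h1 h2 rewrite eq-refl p | ge-no {suc (suc p)} {p} (≤-trans (n≤1+n _) ≤-refl) | eq-no {p} {suc p} (<⇒≢ ≤-refl) | ge-no {suc (suc p)} {suc p} ≤-refl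
          | ge-yes (≤-trans (ge→ r p (sym h1)) (n≤1+n p)) with () ← h2
-- a and b are separated when the only c ∈ S with a ⊕ b ⊕ c ∈ S are a and b,
-- i.e. the only common neighbours of 𝟎 and a ⊕ b are a and b.
Separated : ∀ {n} → V n → V n → Set
Separated a b = ∀ c → InS c → InS ((a ⊕ b) ⊕ c) → c ≡ a ⊎ c ≡ b

separated-consecutive : ∀ {k} t → t ≤ k → Separated {suc (suc k)} (F t) (F (suc t))
separated-consecutive t t≤k c Sc Sabc =
  consecutive-forms t t≤k c (InS⇒SForm Sc) (InS⇒SForm (subst (λ w → InS (w ⊕ c)) (sym (U≡F⊕F t)) Sabc))

separated-distant : ∀ {k} t s → suc (suc (suc t)) ≤ s → s ≤ suc k → Separated {suc (suc k)} (F t) (F s)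
separated-distant t s t+3≤s s≤k+1 c Sc Sabc = distant-forms t s t+3≤s s≤k+1 c (InS⇒SForm Sc) (InS⇒SForm Sabc)

gap-two-neighbours : ∀ {k} t → suc t ≤ k → ∀ c → InS c → InS ((F {suc (suc k)} t ⊕ F (suc (suc t))) ⊕ c) →
  c ≡ F t ⊎ c ≡ F (suc (suc t)) ⊎ c ≡ U t ⊎ c ≡ U (suc t)
gap-two-neighbours t t<k c Sc Sabc =
  gap-two-forms t t<k c (InS⇒SForm Sc) (InS⇒SForm (subst (λ w → InS (w ⊕ c)) (sym (two-units≡gap-two t)) Sabc))

two-units∉S : ∀ {k} t → suc t ≤ k → ¬ InS (U {suc (suc k)} t ⊕ U (suc t))
two-units∉S t t<k S = two-units-not-form t t<k (InS⇒SForm S)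

unit+gap-tail∉S : ∀ {k} p → suc p ≤ k → ¬ InS (U {suc (suc k)} p ⊕ F (suc (suc p)))
unit+gap-tail∉S p p<k S = unit+gap-tail-not-form p p<k (InS⇒SForm S)

module FixingZero {k : ℕ} (k≥2 : 2 ≤ k) (σ : V (suc (suc k)) ↔ V (suc (suc k)))
                  (aut : IsGraphAut σ) (σ𝟎 : Inverse.to σ 𝟎 ≡ 𝟎) where

  open Inverse σ using (to; from; strictlyInverseˡ; strictlyInverseʳ)
  open IsGraphAut aut

  N : ℕ
  N = suc (suc k)

  to-injective : ∀ {x y} → to x ≡ to y → x ≡ y
  to-injective {x} {y} e = trans (sym (strictlyInverseʳ x)) (trans (cong from e) (strictlyInverseʳ y))

  preserves-S-difference : ∀ u w → InS (w ⊕ u) → InS (to w ⊕ to u)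
  preserves-S-difference u w S = adjacent⇒S-difference (adj⇒ u w (S-difference⇒adjacent S))

  reflects-S-difference : ∀ u w → InS (to w ⊕ to u) → InS (w ⊕ u)
  reflects-S-difference u w S = adjacent⇒S-difference (adj⇐ u w (S-difference⇒adjacent S))

  -- Since σ fixes 𝟎, σ and σ⁻¹ map S (the neighbourhood of 𝟎) into S.
  to-maps-S : ∀ {s} → InS s → InS (to s)
  to-maps-S {s} Ss = subst InS (trans (cong (to s ⊕_) σ𝟎) (⊕-idr (to s)))
                       (preserves-S-difference 𝟎 s (subst InS (sym (⊕-idr s)) Ss))

  from-maps-S : ∀ {t} → InS t → InS (from t)
  from-maps-S {t} St = subst InS (⊕-idr (from t)) (reflects-S-difference 𝟎 (from t) (subst InS (sym image) St))
    where
    image : to (from t) ⊕ to 𝟎 ≡ t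
    image = trans (cong₂ _⊕_ (strictlyInverseˡ t) σ𝟎) (⊕-idr t)

  -- If σ(x⊕a) = σx ⊕ A and σ(x⊕b) = σx ⊕ B with A, B ∈ S, then
  -- z = σ⁻¹(σx ⊕ A ⊕ B) is adjacent to x⊕a and x⊕b; writing z = c ⊕ (x⊕a),
  -- both c and a ⊕ b ⊕ c lie in S.
  common-neighbour : ∀ x a b A B → to (x ⊕ a) ≡ to x ⊕ A → to (x ⊕ b) ≡ to x ⊕ B → InS A → InS B →
    Σ (V N) λ c → InS c × InS ((a ⊕ b) ⊕ c) × to (c ⊕ (x ⊕ a)) ≡ (to x ⊕ A) ⊕ B
  common-neighbour x a b A B hA hB SA SB = c , Sc , Sabc , to-c
    where
    target : V N
    target = (to x ⊕ A) ⊕ B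
    z : V N
    z = from target
    c : V N
    c = z ⊕ (x ⊕ a)
    z-from-a : to z ⊕ to (x ⊕ a) ≡ B
    z-from-a = trans (cong₂ _⊕_ (strictlyInverseˡ target) hA)
                     (solve (((x0 ⊹ x1) ⊹ x2) ⊹ (x0 ⊹ x1)) x2 refl (lookup (to x ∷ A ∷ B ∷ [])))
    z-from-b : to z ⊕ to (x ⊕ b) ≡ A
    z-from-b = trans (cong₂ _⊕_ (strictlyInverseˡ target) hB)
                     (solve (((x0 ⊹ x1) ⊹ x2) ⊹ (x0 ⊹ x2)) x1 refl (lookup (to x ∷ A ∷ B ∷ [])))
    Sc : InS c
    Sc = reflects-S-difference (x ⊕ a) z (subst InS (sym z-from-a) SB)
    Sabc : InS ((a ⊕ b) ⊕ c)
    Sabc = subst InS (solve (x0 ⊹ (x1 ⊹ x3)) ((x2 ⊹ x3) ⊹ (x0 ⊹ (x1 ⊹ x2))) refl (lookup (z ∷ x ∷ a ∷ b ∷ [])))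
             (reflects-S-difference (x ⊕ b) z (subst InS (sym z-from-b) SA))
    to-c : to (c ⊕ (x ⊕ a)) ≡ target
    to-c = trans (cong to (⊕-cancelʳ z (x ⊕ a))) (strictlyInverseˡ target)

  -- When the common neighbour is one of the two expected ones, σ is additive
  -- on x ⊕ a ⊕ b.  (If c = a then z = x, forcing A = B and hence a = b.)
  resolve : ∀ x a b A B c → to (x ⊕ a) ≡ to x ⊕ A → to (x ⊕ b) ≡ to x ⊕ B →
    c ≡ a ⊎ c ≡ b → to (c ⊕ (x ⊕ a)) ≡ (to x ⊕ A) ⊕ B → to ((x ⊕ a) ⊕ b) ≡ (to x ⊕ A) ⊕ B
  resolve x a b A B c hA hB (inj₂ refl) e = trans (cong to (⊕-comm (x ⊕ a) c)) e
  resolve x a b A B c hA hB (inj₁ refl) e = begin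
    to ((x ⊕ c) ⊕ b) ≡⟨ cong (λ w → to ((x ⊕ c) ⊕ w)) (sym c≡b) ⟩
    to ((x ⊕ c) ⊕ c) ≡⟨ cong to (⊕-cancelʳ x c) ⟩
    to x             ≡⟨ fixed ⟩
    (to x ⊕ A) ⊕ B   ∎
    where
    fixed : to x ≡ (to x ⊕ A) ⊕ B
    fixed = trans (cong to (solve x1 (x0 ⊹ (x1 ⊹ x0)) refl (lookup (c ∷ x ∷ [])))) e
    A≡B : A ≡ B
    A≡B = begin
      A                                ≡⟨ solve x1 (((x0 ⊹ x1) ⊹ x2) ⊹ (x0 ⊹ x2)) refl (lookup (to x ∷ A ∷ B ∷ [])) ⟩
      ((to x ⊕ A) ⊕ B) ⊕ (to x ⊕ B)    ≡⟨ cong (_⊕ (to x ⊕ B)) (sym fixed) ⟩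
      to x ⊕ (to x ⊕ B)                ≡⟨ ⊕-cancelˡ (to x) B ⟩
      B                                ∎
    c≡b : c ≡ b
    c≡b = trans (sym (⊕-cancelˡ x c))
            (trans (cong (x ⊕_) (to-injective (trans hA (trans (cong (to x ⊕_) A≡B) (sym hB)))))
                   (⊕-cancelˡ x b))

  extend-separated : ∀ x a b A B → to (x ⊕ a) ≡ to x ⊕ A → to (x ⊕ b) ≡ to x ⊕ B → InS A → InS B →
    Separated a b → to ((x ⊕ a) ⊕ b) ≡ (to x ⊕ A) ⊕ B
  extend-separated x a b A B hA hB SA SB sep with common-neighbour x a b A B hA hB SA SB
  ... | c , Sc , Sabc , e = resolve x a b A B c hA hB (sep c Sc Sabc) e

  φ : ℕ → V N
  φ t = to (F t)

  Additive : V N → Set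
  Additive x = ∀ t → t < N → to (x ⊕ F t) ≡ to x ⊕ φ t

  additive-𝟎 : Additive 𝟎
  additive-𝟎 t _ = trans (cong to (⊕-idl (F t))) (sym (trans (cong (_⊕ φ t) σ𝟎) (⊕-idl (φ t))))

  extend-tails : ∀ x → Additive x → ∀ t s → t < N → s < N → Separated (F t) (F s) →
    to ((x ⊕ F t) ⊕ F s) ≡ (to x ⊕ φ t) ⊕ φ s
  extend-tails x ax t s t<N s<N =
    extend-separated x (F t) (F s) (φ t) (φ s) (ax t t<N) (ax s s<N) (to-maps-S (F∈S t t<N)) (to-maps-S (F∈S s s<N))

  additive-consecutive : ∀ x → Additive x → ∀ t → t ≤ k →
    to ((x ⊕ F t) ⊕ F (suc t)) ≡ (to x ⊕ φ t) ⊕ φ (suc t)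
  additive-consecutive x ax t t≤k =
    extend-tails x ax t (suc t) (≤k⇒<N t≤k) (s≤s (s≤s t≤k)) (separated-consecutive t t≤k)

  additive-distant : ∀ x → Additive x → ∀ t s → suc (suc (suc t)) ≤ s → s ≤ suc k →
    to ((x ⊕ F t) ⊕ F s) ≡ (to x ⊕ φ t) ⊕ φ s
  additive-distant x ax t s t+3≤s s≤k+1 =
    extend-tails x ax t s (≤k⇒<N t≤k) (s≤s s≤k+1) (separated-distant t s t+3≤s s≤k+1)
    where
    t≤k : t ≤ k
    t≤k = ≤-trans (≤-trans (n≤1+n t) (n≤1+n (suc t))) (≤-pred (≤-trans t+3≤s s≤k+1))

  -- σ(U t) = φ t ⊕ φ (t+1) lies in S.
  unit-image : ∀ t → t ≤ k → InS (φ t ⊕ φ (suc t))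
  unit-image t t≤k = subst InS image (to-maps-S (U∈S t (≤k⇒<N t≤k)))
    where
    image : to (U t) ≡ φ t ⊕ φ (suc t)
    image = begin
      to (U t)                         ≡⟨ cong to (trans (U≡F⊕F t) (cong (_⊕ F (suc t)) (sym (⊕-idl (F t))))) ⟩
      to ((𝟎 ⊕ F t) ⊕ F (suc t))       ≡⟨ additive-consecutive 𝟎 additive-𝟎 t t≤k ⟩
      (to 𝟎 ⊕ φ t) ⊕ φ (suc t)         ≡⟨ cong (λ w → (w ⊕ φ t) ⊕ φ (suc t)) σ𝟎 ⟩
      (𝟎 ⊕ φ t) ⊕ φ (suc t)            ≡⟨ cong (_⊕ φ (suc t)) (⊕-idl (φ t)) ⟩
      φ t ⊕ φ (suc t)                  ∎

  -- For the pair F t, F (t+2) the common neighbour could also be U t ⊕ x ⊕ F t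
  -- or U (t+1) ⊕ x ⊕ F t; both are excluded by non-adjacency.

  -- c = U t: then σ(x ⊕ F (t+1)) = σx ⊕ φ t ⊕ φ (t+2), so φ (t+2) ⊕ φ t = φ (t+1) ∈ S,
  -- i.e. F t and F (t+2) would be adjacent.
  gap-two-not-U : ∀ x → Additive x → ∀ t → suc t ≤ k →
    to (U t ⊕ (x ⊕ F t)) ≡ (to x ⊕ φ t) ⊕ φ (suc (suc t)) → ⊥
  gap-two-not-U x ax t t<k e =
    two-units∉S t t<k (subst InS tails (reflects-S-difference (F t) (F (suc (suc t))) (subst InS images S-middle)))
    where
    S-middle : InS (φ (suc t))
    S-middle = to-maps-S (F∈S (suc t) (≤k⇒<N t<k))
    shifted : x ⊕ F (suc t) ≡ U t ⊕ (x ⊕ F t)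
    shifted = trans (solve (x0 ⊹ x2) ((x1 ⊹ x2) ⊹ (x0 ⊹ x1)) refl (lookup (x ∷ F t ∷ F (suc t) ∷ [])))
                    (cong (_⊕ (x ⊕ F t)) (sym (U≡F⊕F t)))
    images : φ (suc t) ≡ φ (suc (suc t)) ⊕ φ t
    images = ⊕-shift (to x) (φ t) (φ (suc (suc t))) (φ (suc t))
               (trans (sym (ax (suc t) (≤k⇒<N t<k))) (trans (cong to shifted) e))
    tails : F (suc (suc t)) ⊕ F t ≡ U t ⊕ U (suc t)
    tails = trans (⊕-comm (F (suc (suc t))) (F t)) (sym (two-units≡gap-two t))

  -- c = U (t+1) with t + 2 ≤ k: z would be adjacent to u = x ⊕ F t ⊕ F (t+3),
  -- as σu ⊕ σz = σ(U (t+2)), but u ⊕ z = U (t+1) ⊕ F (t+3) ∉ S.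
  gap-two-not-U⁺-inner : ∀ x → Additive x → ∀ t → suc (suc t) ≤ k →
    to (U (suc t) ⊕ (x ⊕ F t)) ≡ (to x ⊕ φ t) ⊕ φ (suc (suc t)) → ⊥
  gap-two-not-U⁺-inner x ax t t+2≤k e =
    unit+gap-tail∉S (suc t) t+2≤k (subst InS difference (reflects-S-difference z u S-images))
    where
    z u : V N
    z = U (suc t) ⊕ (x ⊕ F t)
    u = (x ⊕ F t) ⊕ F (suc (suc (suc t)))
    to-u : to u ≡ (to x ⊕ φ t) ⊕ φ (suc (suc (suc t)))
    to-u = additive-distant x ax t (suc (suc (suc t))) ≤-refl (s≤s t+2≤k)
    S-images : InS (to u ⊕ to z)
    S-images = subst InS
      (trans (solve (x2 ⊹ x3) (((x0 ⊹ x1) ⊹ x3) ⊹ ((x0 ⊹ x1) ⊹ x2)) refl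
                (lookup (to x ∷ φ t ∷ φ (suc (suc t)) ∷ φ (suc (suc (suc t))) ∷ [])))
             (sym (cong₂ _⊕_ to-u e)))
      (unit-image (suc (suc t)) t+2≤k)
    difference : u ⊕ z ≡ U (suc t) ⊕ F (suc (suc (suc t)))
    difference = solve (((x0 ⊹ x1) ⊹ x2) ⊹ (x3 ⊹ (x0 ⊹ x1))) (x3 ⊹ x2) refl
                   (lookup (x ∷ F t ∷ F (suc (suc (suc t))) ∷ U (suc t) ∷ []))

  -- c = U (t+1) with t + 1 = k (so t = t'+1 as k ≥ 2): z would be adjacent to
  -- u = x ⊕ F t' ⊕ F (t'+3), as σu ⊕ σz = σ(U t'), but u ⊕ z = U t' ⊕ F (t'+2) ∉ S.
  gap-two-not-U⁺-last : ∀ x → Additive x → ∀ t → suc t ≤ k → ¬ suc (suc t) ≤ k →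
    to (U (suc t) ⊕ (x ⊕ F t)) ≡ (to x ⊕ φ t) ⊕ φ (suc (suc t)) → ⊥
  gap-two-not-U⁺-last x ax zero 1≤k 2≰k e = 2≰k k≥2
  gap-two-not-U⁺-last x ax (suc t) t+2≤k _ e =
    unit+gap-tail∉S t t+1≤k (subst InS difference (reflects-S-difference z u S-images))
    where
    t+1≤k : suc t ≤ k
    t+1≤k = ≤-trans (n≤1+n (suc t)) t+2≤k
    z u : V N
    z = U (suc (suc t)) ⊕ (x ⊕ F (suc t))
    u = (x ⊕ F t) ⊕ F (suc (suc (suc t)))
    to-u : to u ≡ (to x ⊕ φ t) ⊕ φ (suc (suc (suc t)))
    to-u = additive-distant x ax t (suc (suc (suc t))) ≤-refl (s≤s t+2≤k)
    S-images : InS (to u ⊕ to z)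
    S-images = subst InS
      (trans (solve (x1 ⊹ x2) (((x0 ⊹ x1) ⊹ x3) ⊹ ((x0 ⊹ x2) ⊹ x3)) refl
                (lookup (to x ∷ φ t ∷ φ (suc t) ∷ φ (suc (suc (suc t))) ∷ [])))
             (sym (cong₂ _⊕_ to-u e)))
      (unit-image t (≤-trans (n≤1+n t) t+1≤k))
    difference : u ⊕ z ≡ U t ⊕ F (suc (suc t))
    difference = begin
      u ⊕ z                                             ≡⟨ cong (λ w → u ⊕ (w ⊕ (x ⊕ F (suc t)))) (U≡F⊕F (suc (suc t))) ⟩
      u ⊕ ((F (suc (suc t)) ⊕ F (suc (suc (suc t)))) ⊕ (x ⊕ F (suc t)))
        ≡⟨ solve (((x0 ⊹ x1) ⊹ x4) ⊹ ((x3 ⊹ x4) ⊹ (x0 ⊹ x2))) ((x1 ⊹ x2) ⊹ x3) refl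
             (lookup (x ∷ F t ∷ F (suc t) ∷ F (suc (suc t)) ∷ F (suc (suc (suc t))) ∷ [])) ⟩
      (F t ⊕ F (suc t)) ⊕ F (suc (suc t))               ≡⟨ cong (_⊕ F (suc (suc t))) (sym (U≡F⊕F t)) ⟩
      U t ⊕ F (suc (suc t))                             ∎

  gap-two-not-U⁺ : ∀ x → Additive x → ∀ t → suc t ≤ k →
    to (U (suc t) ⊕ (x ⊕ F t)) ≡ (to x ⊕ φ t) ⊕ φ (suc (suc t)) → ⊥
  gap-two-not-U⁺ x ax t t<k e with suc (suc t) ≤? k
  ... | yes t+2≤k = gap-two-not-U⁺-inner x ax t t+2≤k e
  ... | no t+2≰k = gap-two-not-U⁺-last x ax t t<k t+2≰k e

  additive-gap-two : ∀ x → Additive x → ∀ t → suc t ≤ k →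
    to ((x ⊕ F t) ⊕ F (suc (suc t))) ≡ (to x ⊕ φ t) ⊕ φ (suc (suc t))
  additive-gap-two x ax t t<k =
    conclude (common-neighbour x (F t) (F (suc (suc t))) (φ t) (φ (suc (suc t))) hA hB
               (to-maps-S (F∈S t t<N)) (to-maps-S (F∈S (suc (suc t)) t+2<N)))
    where
    t<N : t < N
    t<N = ≤k⇒<N (≤-trans (n≤1+n t) t<k)
    t+2<N : suc (suc t) < N
    t+2<N = s≤s (s≤s t<k)
    hA : to (x ⊕ F t) ≡ to x ⊕ φ t
    hA = ax t t<N
    hB : to (x ⊕ F (suc (suc t))) ≡ to x ⊕ φ (suc (suc t))
    hB = ax (suc (suc t)) t+2<N
    conclude : (Σ (V N) λ c → InS c × InS ((F t ⊕ F (suc (suc t))) ⊕ c)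
                               × to (c ⊕ (x ⊕ F t)) ≡ (to x ⊕ φ t) ⊕ φ (suc (suc t))) →
               to ((x ⊕ F t) ⊕ F (suc (suc t))) ≡ (to x ⊕ φ t) ⊕ φ (suc (suc t))
    conclude (c , Sc , Sabc , e) with gap-two-neighbours t t<k c Sc Sabc
    ... | inj₁ c≡a = resolve x _ _ _ _ c hA hB (inj₁ c≡a) e
    ... | inj₂ (inj₁ c≡b) = resolve x _ _ _ _ c hA hB (inj₂ c≡b) e
    ... | inj₂ (inj₂ (inj₁ refl)) = ⊥-elim (gap-two-not-U x ax t t<k e)
    ... | inj₂ (inj₂ (inj₂ refl)) = ⊥-elim (gap-two-not-U⁺ x ax t t<k e)

  additive-pair< : ∀ x → Additive x → ∀ t s → t < s → s < N → to ((x ⊕ F t) ⊕ F s) ≡ (to x ⊕ φ t) ⊕ φ s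
  additive-pair< x ax t s t<s s<N with s ≟ suc t | s ≟ suc (suc t)
  ... | yes refl | _ = additive-consecutive x ax t (≤-pred (≤-pred s<N))
  ... | no _ | yes refl = additive-gap-two x ax t (≤-pred (≤-pred s<N))
  ... | no s≢t+1 | no s≢t+2 = additive-distant x ax t s t+3≤s (≤-pred s<N)
    where
    t+3≤s : suc (suc (suc t)) ≤ s
    t+3≤s = ≤∧≢⇒< (≤∧≢⇒< t<s (λ e → s≢t+1 (sym e))) (λ e → s≢t+2 (sym e))

  additive-pair : ∀ x → Additive x → ∀ t s → t < N → s < N → to ((x ⊕ F t) ⊕ F s) ≡ (to x ⊕ φ t) ⊕ φ s
  additive-pair x ax t s t<N s<N with <-cmp t s
  ... | tri< t<s _ _ = additive-pair< x ax t s t<s s<N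
  ... | tri≈ _ refl _ = trans (cong to (⊕-cancelʳ x (F t))) (sym (⊕-cancelʳ (to x) (φ t)))
  ... | tri> _ _ s<t = trans (cong to (swap x (F t) (F s))) (trans (additive-pair< x ax s t s<t t<N) (swap (to x) (φ s) (φ t)))
    where
    swap : ∀ (p a b : V N) → (p ⊕ a) ⊕ b ≡ (p ⊕ b) ⊕ a
    swap p a b = solve ((x0 ⊹ x1) ⊹ x2) ((x0 ⊹ x2) ⊹ x1) refl (lookup (p ∷ a ∷ b ∷ []))

  additive-step : ∀ x t → t < N → Additive x → Additive (x ⊕ F t)
  additive-step x t t<N ax s s<N = trans (additive-pair x ax t s t<N s<N) (cong (_⊕ φ s) (sym (ax t t<N)))

  all-additive : ∀ x → Additive x
  all-additive = tail-induction Additive additive-𝟎 additive-step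

  linear : ∀ x y → to (x ⊕ y) ≡ to x ⊕ to y
  linear x y = tail-induction (λ y → ∀ x → to (x ⊕ y) ≡ to x ⊕ to y) base step y x
    where
    base : ∀ x → to (x ⊕ 𝟎) ≡ to x ⊕ to 𝟎
    base x = trans (cong to (⊕-idr x)) (sym (trans (cong (to x ⊕_) σ𝟎) (⊕-idr (to x))))
    step : ∀ y t → t < N → (∀ x → to (x ⊕ y) ≡ to x ⊕ to y) → ∀ x → to (x ⊕ (y ⊕ F t)) ≡ to x ⊕ to (y ⊕ F t)
    step y t t<N hy x = begin
      to (x ⊕ (y ⊕ F t))     ≡⟨ cong to (sym (⊕-assoc x y (F t))) ⟩
      to ((x ⊕ y) ⊕ F t)     ≡⟨ all-additive (x ⊕ y) t t<N ⟩
      to (x ⊕ y) ⊕ φ t       ≡⟨ cong (_⊕ φ t) (hy x) ⟩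
      (to x ⊕ to y) ⊕ φ t    ≡⟨ ⊕-assoc (to x) (to y) (φ t) ⟩
      to x ⊕ (to y ⊕ φ t)    ≡⟨ cong (to x ⊕_) (sym (all-additive y t t<N)) ⟩
      to x ⊕ to (y ⊕ F t)    ∎

mainTheorem4 : (n : ℕ) → 4 ≤ n → (σ : V n ↔ V n) → IsGraphAut σ
    → Inverse.to σ 𝟎 ≡ 𝟎
    → ((x y : V n) → Inverse.to σ (x ⊕ y) ≡ Inverse.to σ x ⊕ Inverse.to σ y)
      × ((s : V n) → InS s → InS (Inverse.to σ s))
      × ((t : V n) → InS t → Σ (V n) (λ s → InS s × Inverse.to σ s ≡ t))
mainTheorem4 _ (s≤s (s≤s 2≤k)) σ aut σ𝟎 =
  linear , (λ s → to-maps-S) , (λ t St → from t , from-maps-S St , strictlyInverseˡ t)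
  where
  open FixingZero 2≤k σ aut σ𝟎
  open Inverse σ using (from; strictlyInverseˡ)
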